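{- Let $q$ be even and $t\in\mathbb F_{q^4}\setminus\mathbb F_{q^2}$. Let $M_{\mathbf t}$ be the line of $\mathrm{PG}(3,q^4)$ spanned by the points $\langle(1,t^q,t,t^{q+1})\rangle$ and $\langle(1,t^{q^3},t^{q^2},t^{q^3+q^2})\rangle$. Then $M_{\mathbf t}\cap V(4,q^2)$ (the set of vectors of the $2$-dimensional $\mathbb F_{q^4}$-subspace $M_{\mathbf t}$ all of whose coordinates lie in $\mathbb F_{q^2}$) is a line $m_{\mathbf t}$ of $H(3,q^2)$, and $m_{\mathbf t}$ is disjoint from $\widehat{\mathcal W}$.
   Context: $V(4,q^2)$ is embedded in $V(4,q^4)$ by extension of scalars. On $V(4,q^2)$ let $h(\mathbf X,\mathbf Y)=X_1Y_4^q+X_2Y_2^q+X_3Y_3^q+X_4Y_1^q$; $H(3,q^2)$ is the associated unitary polar space, whose lines are the $2$-dimensional $\mathbb F_{q^2}$-subspaces totally isotropic for $h$. Let $\widehat V=\{(\alpha,x^q,x,\beta):\alpha,\beta\in\mathbb F_q,x\in\mathbb F_{q^2}\}$ (a $4$-dimensional $\mathbb F_q$-space), on which $h$ restricts to the non-degenerate alternating form $\widehat b(v,v')=\alpha\beta'+\beta\alpha'+xx'^q+x^qx'$ defining a symplectic polar space $W(3,q)$. $\widehat{\mathcal W}$ denotes the set of $\mathbb F_{q^2}$-spans of totally isotropic subspaces of $(\widehat V,\widehat b)$; a line is disjoint from $\widehat{\mathcal W}$ if it contains no point $\langle v\rangle$ with $v\in\widehat V\setminus\{0\}$. -}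

module Defs where

open import Level using (Level; _⊔_) renaming (suc to lsuc)
open import Data.Nat using (ℕ; zero; suc) renaming (_^_ to _^ℕ_; _+_ to _+ℕ_)
open import Data.Fin using (Fin; zero; suc)
open import Data.Product using (Σ; ∃; _×_; _,_)
open import Relation.Nullary using (¬_)
open import Algebra.Bundles using (CommutativeRing)

record Field (c ℓ : Level) : Set (lsuc (c ⊔ ℓ)) where
  field
    commutativeRing : CommutativeRing c ℓ
  open CommutativeRing commutativeRing public
  field
    0≉1     : ¬ (0# ≈ 1#)
    inverse : ∀ x → ¬ (x ≈ 0#) → ∃ λ y → x * y ≈ 1#

-- Geometry over a field K (intended: K = F_{q^4}), with parameter q.
module Geom {c ℓ : Level} (K : Field c ℓ) (q : ℕ) where
  open Field K using (Carrier; _≈_; _+_; _*_; 0#; 1#)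

  pow : Carrier → ℕ → Carrier
  pow x zero    = 1#
  pow x (suc n) = x * pow x n

  InFq2 : Carrier → Set ℓ
  InFq2 x = pow x (q ^ℕ 2) ≈ x

  InFq : Carrier → Set ℓ
  InFq x = pow x q ≈ x

  -- vectors of V(4, K); coordinates indexed 0..3 (paper's X_1..X_4)
  Vec4 : Set c
  Vec4 = Fin 4 → Carrier

  vec4 : Carrier → Carrier → Carrier → Carrier → Vec4
  vec4 a b d e zero                   = a
  vec4 a b d e (suc zero)             = b
  vec4 a b d e (suc (suc zero))       = d
  vec4 a b d e (suc (suc (suc zero))) = e

  _≋_ : Vec4 → Vec4 → Set ℓ
  v ≋ w = ∀ i → v i ≈ w i

  IsZero : Vec4 → Set ℓ
  IsZero v = ∀ i → v i ≈ 0#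

  lin : Carrier → Vec4 → Carrier → Vec4 → Vec4
  lin l v m w i = l * v i + m * w i

  InV4q2 : Vec4 → Set ℓ
  InV4q2 v = ∀ i → InFq2 (v i)

  h : Vec4 → Vec4 → Carrier
  h X Y = X (zero) * pow (Y (suc (suc (suc zero)))) q
        + X (suc zero) * pow (Y (suc zero)) q
        + X (suc (suc zero)) * pow (Y (suc (suc zero))) q
        + X (suc (suc (suc zero))) * pow (Y zero) q

  -- S is a line of H(3,q^2): a 2-dimensional F_{q^2}-subspace of V(4,q^2)
  -- (the F_{q^2}-span of two F_{q^2}-independent vectors of V(4,q^2))
  -- which is totally isotropic for h.
  IsHermitianLine : (Vec4 → Set (c ⊔ ℓ)) → Set (c ⊔ ℓ)
  IsHermitianLine S =
    (Σ Vec4 λ a → Σ Vec4 λ b →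
        InV4q2 a × InV4q2 b
      × (∀ l m → InFq2 l → InFq2 m → IsZero (lin l a m b) → (l ≈ 0#) × (m ≈ 0#))
      × (∀ v → (S v → Σ Carrier λ l → Σ Carrier λ m → InFq2 l × InFq2 m × (v ≋ lin l a m b))
             × ((Σ Carrier λ l → Σ Carrier λ m → InFq2 l × InFq2 m × (v ≋ lin l a m b)) → S v)))
    × (∀ X Y → S X → S Y → h X Y ≈ 0#)

  InVhat : Vec4 → Set (c ⊔ ℓ)
  InVhat v = Σ Carrier λ α → Σ Carrier λ β → Σ Carrier λ x →
    InFq α × InFq β × InFq2 x × (v ≋ vec4 α (pow x q) x β)

  -- a set of vectors (line) is disjoint from Ŵ: contains no nonzero v ∈ V̂
  DisjointFromWhat : (Vec4 → Set (c ⊔ ℓ)) → Set (c ⊔ ℓ)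
  DisjointFromWhat S = ∀ v → InVhat v → ¬ IsZero v → ¬ S v

  uₜ : Carrier → Vec4
  uₜ t = vec4 1# (pow t q) t (pow t (q +ℕ 1))

  wₜ : Carrier → Vec4
  wₜ t = vec4 1# (pow t (q ^ℕ 3)) (pow t (q ^ℕ 2)) (pow t (q ^ℕ 3 +ℕ q ^ℕ 2))

  InM : Carrier → Vec4 → Set (c ⊔ ℓ)
  InM t v = Σ Carrier λ l → Σ Carrier λ m → v ≋ lin l (uₜ t) m (wₜ t)

  Inm : Carrier → Vec4 → Set (c ⊔ ℓ)
  Inm t v = InM t v × InV4q2 v

-- Since |K| = q⁴ is even, K has characteristic 2; its additive group then has exponent 2, so
-- |K| and hence q are powers of 2 and σ : x ↦ x^q is a ring endomorphism with σ⁴ = id.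
-- Up to normalising exponents, u_t = U and w_t = W, and σ² swaps U and W. Comparing
-- ξU + μW with its σ²-image shows that it lies in V(4,q²) iff μ = σ²(ξ), so m_t consists of
-- the points ξU + σ²(ξ)W; writing ξ = l + m t in the 𝔽_{q²}-basis {1, t} of K exhibits m_t
-- as the 𝔽_{q²}-span of U + W and tU + t^{q²}W, and total isotropy is a polynomial identity
-- in characteristic 2. A point of V̂ of this form has first and last coordinates in 𝔽_q:
-- the first forces ξ^q = ξ, and then the last forces ξ (t + t^{q²})(t^q + t^{q³}) = 0, so ξ = 0.

module Submission where

open import Defs
open import Data.Nat using (ℕ; _^_)
open import Data.Nat.Divisibility using (_∣_)
open import Data.Fin using (Fin)
open import Data.Product using (_×_)
open import Relation.Nullary using (¬_)
open import Function.Bundles using (Bijection)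
open import Relation.Binary.PropositionalEquality using (setoid)
open import Relation.Binary.Bundles using (Setoid)

open import Algebra.Bundles using (AbelianGroup; CommutativeRing)
open import Algebra.Solver.Ring.AlmostCommutativeRing using (_-Raw-AlmostCommutative⟶_; fromCommutativeRing)
open import Data.Bool using (Bool; true; false)
open import Data.Bool.Properties using (xor-∧-commutativeRing)
open import Data.Fin using (zero; suc; remQuot; combine; punchIn; punchOut)
open import Data.Fin.Patterns using (0F; 1F; 2F; 3F)
open import Data.Fin.Permutation using (Permutation; permutation)
import Data.Fin.Properties as Fin
open import Data.Maybe using (Maybe; just; nothing)
open import Data.Nat as ℕ using (zero; suc; _≤_)
open import Data.Nat.Coprimality using (Coprime; coprime-divisor)
open import Data.Nat.Divisibility using (divides; _∣?_; ∣1⇒≡1; *-cancelʳ-∣; ∣-trans; m∣m*n)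
open import Data.Nat.Primality using (irreducible[2])
import Data.Nat.Properties as ℕ
open import Data.Product using (∃; _,_; proj₁; proj₂; uncurry)
open import Data.Sum using (inj₁; inj₂)
open import Function using (_∘_)
open import Level using (_⊔_)
open import Relation.Binary.Definitions using (Decidable)
open import Relation.Binary.PropositionalEquality as ≡ using (_≡_)
open import Relation.Nullary using (Dec; yes; no; contradiction)
import Relation.Nullary.Decidable as Dec

odd⇒coprime-2 : ∀ {m} → ¬ 2 ∣ m → Coprime m 2
odd⇒coprime-2 2∤m (d∣m , d∣2) with irreducible[2] d∣2
... | inj₁ d≡1    = d≡1
... | inj₂ ≡.refl = contradiction d∣m 2∤m

∣2^⇒≡2^ : ∀ d {m} → m ∣ 2 ^ d → ∃ λ e → m ≡ 2 ^ e
∣2^⇒≡2^ zero    m∣1 = 0 , ∣1⇒≡1 m∣1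
∣2^⇒≡2^ (suc d) {m} m∣2^[1+d] with 2 ∣? m
... | no 2∤m = ∣2^⇒≡2^ d (coprime-divisor (odd⇒coprime-2 2∤m) m∣2^[1+d])
... | yes (divides k ≡.refl)
  with e , ≡.refl ← ∣2^⇒≡2^ d {k} (*-cancelʳ-∣ 2 (≡.subst (k ℕ.* 2 ∣_) (ℕ.*-comm 2 (2 ^ d)) m∣2^[1+d]))
  = suc e , ℕ.*-comm (2 ^ e) 2

module Enumeration {c ℓ} {S : Setoid c ℓ} {n : ℕ} (enum : Bijection (setoid (Fin n)) S) where
  open Setoid S
  open Bijection enum

  index : Carrier → Fin n
  index = to⁻

  to-index : ∀ x → to (index x) ≈ x
  to-index x = proj₂ (strictlySurjective x)

  index-injective : ∀ {x y} → index x ≡ index y → x ≈ y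
  index-injective {x} {y} eq = trans (sym (to-index x)) (trans (reflexive (≡.cong to eq)) (to-index y))

  index-cong : ∀ {x y} → x ≈ y → index x ≡ index y
  index-cong {x} {y} x≈y = injective (trans (to-index x) (trans x≈y (sym (to-index y))))

  _≟_ : Decidable _≈_
  x ≟ y = Dec.map′ index-injective index-cong (index x Fin.≟ index y)

HasExponentTwo : ∀ {a ℓ} → AbelianGroup a ℓ → Set (a ⊔ ℓ)
HasExponentTwo G = ∀ x → x ∙ x ≈ ε
  where open AbelianGroup G

module ExponentTwo {a ℓ} (G : AbelianGroup a ℓ) (x∙x≈ε : HasExponentTwo G) where
  open AbelianGroup G hiding (setoid)
  open import Algebra.Properties.Group group using (∙-cancelˡ)
  open import Algebra.Properties.CommutativeSemigroup commutativeSemigroup using (x∙yz≈y∙xz; interchange)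
  open import Relation.Binary.Reasoning.Setoid (AbelianGroup.setoid G)

  record FiniteSubgroup (m : ℕ) : Set (a ⊔ ℓ) where
    field
      elem           : Fin m → Carrier
      elem-injective : ∀ {i j} → elem i ≈ elem j → i ≡ j
      ∙-closed       : ∀ i j → ∃ λ k → elem i ∙ elem j ≈ elem k

  trivial : FiniteSubgroup 1
  trivial = record
    { elem           = λ _ → ε
    ; elem-injective = λ { {zero} {zero} _ → ≡.refl }
    ; ∙-closed       = λ _ _ → zero , identityˡ ε
    }

  xy∙y≈x : ∀ x y → (x ∙ y) ∙ y ≈ x
  xy∙y≈x x y = begin
    (x ∙ y) ∙ y  ≈⟨ assoc x y y ⟩
    x ∙ (y ∙ y)  ≈⟨ ∙-congˡ (x∙x≈ε y) ⟩
    x ∙ ε        ≈⟨ identityʳ x ⟩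
    x            ∎

  xy∙xz≈y∙z : ∀ x y z → (x ∙ y) ∙ (x ∙ z) ≈ y ∙ z
  xy∙xz≈y∙z x y z = begin
    (x ∙ y) ∙ (x ∙ z)  ≈⟨ interchange x y x z ⟩
    (x ∙ x) ∙ (y ∙ z)  ≈⟨ ∙-congʳ (x∙x≈ε x) ⟩
    ε ∙ (y ∙ z)        ≈⟨ identityˡ (y ∙ z) ⟩
    y ∙ z              ∎

  -- H ∪ gH for g ∉ H, indexed through Fin (2 * m) ≅ Fin 2 × Fin m.
  adjoin : ∀ {m} (H : FiniteSubgroup m) (g : Carrier) →
           (∀ i → ¬ FiniteSubgroup.elem H i ≈ g) → FiniteSubgroup (2 ℕ.* m)
  adjoin {m} H g g∉H = record
    { elem           = coset ∘ remQuot m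
    ; elem-injective = remQuot-injective ∘ coset-injective _ _
    ; ∙-closed       = λ k k′ → ∙-closed′ (remQuot m k) (remQuot m k′)
    }
    where
    open FiniteSubgroup H

    coset : Fin 2 × Fin m → Carrier
    coset (zero     , i) = elem i
    coset (suc zero , i) = g ∙ elem i

    remQuot-injective : ∀ {k k′} → remQuot {2} m k ≡ remQuot m k′ → k ≡ k′
    remQuot-injective {k} {k′} eq = ≡.trans (≡.sym (Fin.combine-remQuot m k))
      (≡.trans (≡.cong (uncurry combine) eq) (Fin.combine-remQuot m k′))

    remQuot-combine : ∀ p → remQuot {2} m (uncurry combine p) ≡ p
    remQuot-combine (i , j) = Fin.remQuot-combine i j

    cosets-disjoint : ∀ i j → ¬ elem i ≈ g ∙ elem j
    cosets-disjoint i j eᵢ≈geⱼ with ∙-closed i j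
    ... | k , eᵢeⱼ≈eₖ = g∉H k (begin
      elem k                 ≈⟨ eᵢeⱼ≈eₖ ⟨
      elem i ∙ elem j        ≈⟨ ∙-congʳ eᵢ≈geⱼ ⟩
      (g ∙ elem j) ∙ elem j  ≈⟨ xy∙y≈x g (elem j) ⟩
      g                      ∎)

    coset-injective : ∀ p p′ → coset p ≈ coset p′ → p ≡ p′
    coset-injective (zero     , i) (zero     , j) e = ≡.cong (zero ,_) (elem-injective e)
    coset-injective (zero     , i) (suc zero , j) e = contradiction e (cosets-disjoint i j)
    coset-injective (suc zero , i) (zero     , j) e = contradiction (sym e) (cosets-disjoint j i)
    coset-injective (suc zero , i) (suc zero , j) e = ≡.cong (suc zero ,_) (elem-injective (∙-cancelˡ g _ _ e))

    coset-closed : ∀ p p′ → ∃ λ p″ → coset p ∙ coset p′ ≈ coset p″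
    coset-closed (zero , i) (zero , j) with ∙-closed i j
    ... | k , e = (zero , k) , e
    coset-closed (zero , i) (suc zero , j) with ∙-closed i j
    ... | k , e = (suc zero , k) , trans (x∙yz≈y∙xz (elem i) g (elem j)) (∙-congˡ e)
    coset-closed (suc zero , i) (zero , j) with ∙-closed i j
    ... | k , e = (suc zero , k) , trans (assoc g (elem i) (elem j)) (∙-congˡ e)
    coset-closed (suc zero , i) (suc zero , j) with ∙-closed i j
    ... | k , e = (zero , k) , trans (xy∙xz≈y∙z g (elem i) (elem j)) e

    ∙-closed′ : ∀ p p′ → ∃ λ k → coset p ∙ coset p′ ≈ coset (remQuot m k)
    ∙-closed′ p p′ with coset-closed p p′
    ... | p″ , e = uncurry combine p″ , trans e (reflexive (≡.cong coset (≡.sym (remQuot-combine p″))))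

  module _ {n} (enum : Bijection (setoid (Fin n)) (AbelianGroup.setoid G)) where
    open Bijection enum using (to; injective)
    open Enumeration enum
    open FiniteSubgroup

    Contains : ∀ {m} → FiniteSubgroup m → Fin n → Set _
    Contains H j = ∃ λ i → elem H i ≈ to j

    contains? : ∀ {m} (H : FiniteSubgroup m) j → Dec (Contains H j)
    contains? H j = Fin.any? (λ i → elem H i ≟ to j)

    size≤card : ∀ {m} → FiniteSubgroup m → m ≤ n
    size≤card H = Fin.injective⇒≤ (λ e → elem-injective H (index-injective e))

    card≤size : ∀ {m} (H : FiniteSubgroup m) → (∀ j → Contains H j) → n ≤ m
    card≤size H covers = Fin.injective⇒≤ {f = proj₁ ∘ covers} λ {j} {j′} e → injective (begin
      to j                        ≈⟨ proj₂ (covers j) ⟨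
      elem H (proj₁ (covers j))   ≡⟨ ≡.cong (elem H) e ⟩
      elem H (proj₁ (covers j′))  ≈⟨ proj₂ (covers j′) ⟩
      to j′                       ∎)

    -- The fuel only ensures termination: once it runs out, n ≤ 2 ^ k ≤ n.
    grow : ∀ fuel {k} → FiniteSubgroup (2 ^ k) → n ≤ 2 ^ k ℕ.+ fuel → ∃ λ d → n ≡ 2 ^ d
    grow zero {k} H n≤ = k , ℕ.≤-antisym (ℕ.≤-trans n≤ (ℕ.≤-reflexive (ℕ.+-identityʳ _))) (size≤card H)
    grow (suc fuel) {k} H n≤ with Fin.all? (contains? H)
    ... | yes covers = k , ℕ.≤-antisym (card≤size H covers) (size≤card H)
    ... | no ¬covers with Fin.¬∀⟶∃¬ n (Contains H) (contains? H) ¬covers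
    ...   | j , j∉H = grow fuel {suc k} (adjoin H (to j) (λ i e → j∉H (i , e))) (ℕ.≤-trans n≤ step)
      where
      step : 2 ^ k ℕ.+ suc fuel ≤ 2 ^ suc k ℕ.+ fuel
      step = ℕ.≤-trans (ℕ.≤-reflexive (ℕ.+-suc (2 ^ k) fuel))
                       (ℕ.+-monoˡ-≤ fuel (ℕ.^-monoʳ-< 2 (ℕ.s≤s (ℕ.s≤s ℕ.z≤n)) (ℕ.n<1+n k)))

    card≡2^ : ∃ λ d → n ≡ 2 ^ d
    card≡2^ = grow n {0} trivial (ℕ.m≤n+m n 1)

HasCharacteristicTwo : ∀ {c ℓ} → CommutativeRing c ℓ → Set ℓ
HasCharacteristicTwo R = 1# + 1# ≈ 0#
  where open CommutativeRing R

-- Ring normalisation with coefficients in 𝔽₂ = (Bool, xor, ∧), sound in any ring with 1 + 1 ≈ 0.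
module CharacteristicTwo {c ℓ} (R : CommutativeRing c ℓ) (1+1≈0 : HasCharacteristicTwo R) where
  open CommutativeRing R hiding (setoid)
  open import Algebra.Properties.Ring ring using (-0#≈0#)
  open import Algebra.Properties.Semiring.Exp semiring using (^-congˡ; ^-assocʳ) renaming (_^_ to _^ᴿ_)
  open import Relation.Binary.Reasoning.Setoid (CommutativeRing.setoid R)

  -1≈1 : - 1# ≈ 1#
  -1≈1 = begin
    - 1#               ≈⟨ +-identityʳ (- 1#) ⟨
    - 1# + 0#          ≈⟨ +-congˡ 1+1≈0 ⟨
    - 1# + (1# + 1#)   ≈⟨ +-assoc (- 1#) 1# 1# ⟨
    (- 1# + 1#) + 1#   ≈⟨ +-congʳ (-‿inverseˡ 1#) ⟩
    0# + 1#            ≈⟨ +-identityˡ 1# ⟩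
    1#                 ∎

  ⟦_⟧ᴮ : Bool → Carrier
  ⟦ true  ⟧ᴮ = 1#
  ⟦ false ⟧ᴮ = 0#

  𝔽₂-morphism : CommutativeRing.rawRing xor-∧-commutativeRing -Raw-AlmostCommutative⟶ fromCommutativeRing R
  𝔽₂-morphism = record
    { ⟦_⟧    = ⟦_⟧ᴮ
    ; +-homo = λ { true true → sym 1+1≈0 ; true false → sym (+-identityʳ 1#) ; false _ → sym (+-identityˡ _) }
    ; *-homo = λ { true _ → sym (*-identityˡ _) ; false _ → sym (zeroˡ _) }
    ; -‿homo = λ { true → sym -1≈1 ; false → sym -0#≈0# }
    ; 0-homo = refl
    ; 1-homo = refl
    }

  _≟ᴮ_ : ∀ a b → Maybe (⟦ a ⟧ᴮ ≈ ⟦ b ⟧ᴮ)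
  true  ≟ᴮ true  = just refl
  false ≟ᴮ false = just refl
  _     ≟ᴮ _     = nothing

  open import Algebra.Solver.Ring _ _ 𝔽₂-morphism _≟ᴮ_ public using (solve; con; _:+_; _:*_; _:=_)

  x+x≈0 : ∀ x → x + x ≈ 0#
  x+x≈0 = solve 1 (λ x → x :+ x := con false) refl

  ≈⇒+≈0 : ∀ {x y} → x ≈ y → x + y ≈ 0#
  ≈⇒+≈0 {x} {y} x≈y = trans (+-congʳ x≈y) (x+x≈0 y)

  +≈0⇒≈ : ∀ {x y} → x + y ≈ 0# → x ≈ y
  +≈0⇒≈ {x} {y} x+y≈0 = begin
    x              ≈⟨ solve 2 (λ x y → x := (x :+ y) :+ y) refl x y ⟩
    (x + y) + y    ≈⟨ +-congʳ x+y≈0 ⟩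
    0# + y         ≈⟨ +-identityˡ y ⟩
    y              ∎

  [x+y]²≈x²+y² : ∀ x y → (x + y) ^ᴿ 2 ≈ x ^ᴿ 2 + y ^ᴿ 2
  [x+y]²≈x²+y² = solve 2 (λ x y → (x :+ y) :* ((x :+ y) :* con true)
                               := x :* (x :* con true) :+ y :* (y :* con true)) refl

  frobenius : ∀ e x y → (x + y) ^ᴿ (2 ^ e) ≈ x ^ᴿ (2 ^ e) + y ^ᴿ (2 ^ e)
  frobenius zero    x y = solve 2 (λ x y → (x :+ y) :* con true := x :* con true :+ y :* con true) refl x y
  frobenius (suc e) x y = begin
    (x + y) ^ᴿ (2 ℕ.* 2 ^ e)                   ≈⟨ ^-assocʳ (x + y) 2 (2 ^ e) ⟨
    ((x + y) ^ᴿ 2) ^ᴿ (2 ^ e)                  ≈⟨ ^-congˡ (2 ^ e) ([x+y]²≈x²+y² x y) ⟩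
    (x ^ᴿ 2 + y ^ᴿ 2) ^ᴿ (2 ^ e)               ≈⟨ frobenius e (x ^ᴿ 2) (y ^ᴿ 2) ⟩
    (x ^ᴿ 2) ^ᴿ (2 ^ e) + (y ^ᴿ 2) ^ᴿ (2 ^ e)  ≈⟨ +-cong (^-assocʳ x 2 (2 ^ e)) (^-assocʳ y 2 (2 ^ e)) ⟩
    x ^ᴿ (2 ℕ.* 2 ^ e) + y ^ᴿ (2 ℕ.* 2 ^ e)    ∎

module FiniteField {c ℓ} (K : Field c ℓ) where
  open Field K hiding (setoid; zero)
  open import Algebra.Properties.Semiring.Exp semiring public using () renaming (_^_ to _^ᴿ_)
  open import Algebra.Properties.Semiring.Exp semiring using (^-congˡ; ^-assocʳ)
  open import Algebra.Properties.Ring ring using (-1*x≈-x; -‿involutive)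
  open import Algebra.Properties.CommutativeSemigroup *-commutativeSemigroup using (interchange)
  open import Algebra.Properties.CommutativeMonoid.Sum *-commutativeMonoid
    using (sum-permute; sum-cong-≋) renaming (sum to ∏)
  open import Relation.Binary.Reasoning.Setoid (Field.setoid K)

  *-cancelˡ : ∀ {d x y} → ¬ d ≈ 0# → d * x ≈ d * y → x ≈ y
  *-cancelˡ {d} {x} {y} d≉0 dx≈dy with inverse d d≉0
  ... | d⁻¹ , dd⁻¹≈1 = begin
    x                ≈⟨ *-identityˡ x ⟨
    1# * x           ≈⟨ *-congʳ (trans (sym dd⁻¹≈1) (*-comm d d⁻¹)) ⟩
    (d⁻¹ * d) * x    ≈⟨ *-assoc d⁻¹ d x ⟩
    d⁻¹ * (d * x)    ≈⟨ *-congˡ dx≈dy ⟩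
    d⁻¹ * (d * y)    ≈⟨ *-assoc d⁻¹ d y ⟨
    (d⁻¹ * d) * y    ≈⟨ *-congʳ (trans (*-comm d⁻¹ d) dd⁻¹≈1) ⟩
    1# * y           ≈⟨ *-identityˡ y ⟩
    y                ∎

  x≉0∧x*y≈0⇒y≈0 : ∀ {x y} → ¬ x ≈ 0# → x * y ≈ 0# → y ≈ 0#
  x≉0∧x*y≈0⇒y≈0 {x} x≉0 xy≈0 = *-cancelˡ x≉0 (trans xy≈0 (sym (zeroʳ x)))

  *-≉0 : ∀ {x y} → ¬ x ≈ 0# → ¬ y ≈ 0# → ¬ x * y ≈ 0#
  *-≉0 x≉0 y≉0 xy≈0 = y≉0 (x≉0∧x*y≈0⇒y≈0 x≉0 xy≈0)

  ∏-≉0 : ∀ {k} (f : Fin k → Carrier) → (∀ j → ¬ f j ≈ 0#) → ¬ ∏ f ≈ 0#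
  ∏-≉0 {zero}  f f≉0 1≈0 = 0≉1 (sym 1≈0)
  ∏-≉0 {suc k} f f≉0 = *-≉0 (f≉0 zero) (∏-≉0 (f ∘ suc) (f≉0 ∘ suc))

  ∏-scale : ∀ x {k} (f : Fin k → Carrier) → ∏ (λ j → x * f j) ≈ x ^ᴿ k * ∏ f
  ∏-scale x {zero}  f = sym (*-identityʳ 1#)
  ∏-scale x {suc k} f = begin
    (x * f zero) * ∏ (λ j → x * f (suc j))  ≈⟨ *-congˡ (∏-scale x (f ∘ suc)) ⟩
    (x * f zero) * (x ^ᴿ k * ∏ (f ∘ suc))   ≈⟨ interchange x (f zero) (x ^ᴿ k) (∏ (f ∘ suc)) ⟩
    (x * x ^ᴿ k) * (f zero * ∏ (f ∘ suc))   ∎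

  IsAdditivePower : ℕ → Set (c ⊔ ℓ)
  IsAdditivePower n = ∀ x y → (x + y) ^ᴿ n ≈ x ^ᴿ n + y ^ᴿ n

  IsIdentityPower : ℕ → Set (c ⊔ ℓ)
  IsIdentityPower n = ∀ x → x ^ᴿ n ≈ x

  pow≡^ᴿ : ∀ q x n → Geom.pow K q x n ≡ x ^ᴿ n
  pow≡^ᴿ q x zero    = ≡.refl
  pow≡^ᴿ q x (suc n) = ≡.cong (x *_) (pow≡^ᴿ q x n)

  1^≈1 : ∀ n → 1# ^ᴿ n ≈ 1#
  1^≈1 zero    = refl
  1^≈1 (suc n) = trans (*-identityˡ _) (1^≈1 n)

  -- Multiplication by x ≉ 0 permutes the nonzero elements, so x ^ |K ˣ| ≈ 1.
  module Units {m} (enum : Bijection (setoid (Fin (suc m))) (Field.setoid K)) where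
    open Bijection enum using (to; injective)
    open Enumeration enum

    unit : Fin m → Carrier
    unit j = to (punchIn (index 0#) j)

    unit-≉0 : ∀ j → ¬ unit j ≈ 0#
    unit-≉0 j uⱼ≈0 = Fin.punchInᵢ≢i (index 0#) j (injective (trans uⱼ≈0 (sym (to-index 0#))))

    unit-injective : ∀ {j k} → unit j ≈ unit k → j ≡ k
    unit-injective e = Fin.punchIn-injective (index 0#) _ _ (injective e)

    scale : ∀ {x} → ¬ x ≈ 0# → Fin m → Fin m
    scale {x} x≉0 j = punchOut {i = index 0#} {j = index (x * unit j)}
      λ eq → *-≉0 x≉0 (unit-≉0 j) (index-injective (≡.sym eq))

    unit-scale : ∀ {x} (x≉0 : ¬ x ≈ 0#) j → unit (scale x≉0 j) ≈ x * unit j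
    unit-scale x≉0 j = trans (reflexive (≡.cong to (Fin.punchIn-punchOut _))) (to-index _)

    scale-inverse : ∀ {x y} (x≉0 : ¬ x ≈ 0#) (y≉0 : ¬ y ≈ 0#) → x * y ≈ 1# →
                    ∀ j → scale x≉0 (scale y≉0 j) ≡ j
    scale-inverse {x} {y} x≉0 y≉0 xy≈1 j = unit-injective (begin
      unit (scale x≉0 (scale y≉0 j))  ≈⟨ unit-scale x≉0 _ ⟩
      x * unit (scale y≉0 j)          ≈⟨ *-congˡ (unit-scale y≉0 j) ⟩
      x * (y * unit j)                ≈⟨ *-assoc x y (unit j) ⟨
      (x * y) * unit j                ≈⟨ *-congʳ xy≈1 ⟩
      1# * unit j                     ≈⟨ *-identityˡ (unit j) ⟩
      unit j                          ∎)

    x^[card-1]≈1 : ∀ {x} → ¬ x ≈ 0# → x ^ᴿ m ≈ 1#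
    x^[card-1]≈1 {x} x≉0 with inverse x x≉0
    ... | y , xy≈1 = sym (*-cancelˡ (∏-≉0 unit unit-≉0) (begin
      ∏ unit * 1#                ≈⟨ *-identityʳ (∏ unit) ⟩
      ∏ unit                     ≈⟨ sum-permute unit π ⟩
      ∏ (unit ∘ scale x≉0)       ≈⟨ sum-cong-≋ (unit-scale x≉0) ⟩
      ∏ (λ j → x * unit j)       ≈⟨ ∏-scale x unit ⟩
      x ^ᴿ m * ∏ unit            ≈⟨ *-comm (x ^ᴿ m) (∏ unit) ⟩
      ∏ unit * x ^ᴿ m            ∎))
      where
      y≉0 : ¬ y ≈ 0#
      y≉0 y≈0 = 0≉1 (trans (sym (zeroʳ x)) (trans (*-congˡ (sym y≈0)) xy≈1))
      π : Permutation m m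
      π = permutation (scale x≉0) (scale y≉0)
            (scale-inverse x≉0 y≉0 xy≈1) (scale-inverse y≉0 x≉0 (trans (*-comm y x) xy≈1))

  x^card≈x : ∀ {n} → Bijection (setoid (Fin n)) (Field.setoid K) → ∀ x → x ^ᴿ n ≈ x
  x^card≈x {zero}  enum x = contradiction (Enumeration.index enum 0#) λ ()
  x^card≈x {suc m} enum x with Enumeration._≟_ enum x 0#
  ... | yes x≈0 = trans (*-congʳ x≈0) (trans (zeroˡ _) (sym x≈0))
  ... | no x≉0  = trans (*-congˡ (Units.x^[card-1]≈1 enum x≉0)) (*-identityʳ x)

  even-card⇒1+1≈0 : ∀ {n} → 2 ∣ n → Bijection (setoid (Fin n)) (Field.setoid K) →
                    HasCharacteristicTwo commutativeRing
  even-card⇒1+1≈0 {n} (divides k ≡.refl) enum = begin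
    1# + 1#       ≈⟨ +-congˡ -1≈1 ⟨
    1# + - 1#     ≈⟨ -‿inverseʳ 1# ⟩
    0#            ∎
    where
    [-1]²≈1 : (- 1#) ^ᴿ 2 ≈ 1#
    [-1]²≈1 = trans (*-congˡ (*-identityʳ (- 1#))) (trans (-1*x≈-x (- 1#)) (-‿involutive 1#))
    -1≈1 : - 1# ≈ 1#
    -1≈1 = begin
      - 1#                 ≈⟨ x^card≈x enum (- 1#) ⟨
      (- 1#) ^ᴿ (k ℕ.* 2)  ≡⟨ ≡.cong ((- 1#) ^ᴿ_) (ℕ.*-comm k 2) ⟩
      (- 1#) ^ᴿ (2 ℕ.* k)  ≈⟨ ^-assocʳ (- 1#) 2 k ⟨
      ((- 1#) ^ᴿ 2) ^ᴿ k   ≈⟨ ^-congˡ k [-1]²≈1 ⟩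
      1# ^ᴿ k              ≈⟨ 1^≈1 k ⟩
      1#                   ∎

module HermitianLine {c ℓ} (K : Field c ℓ) (q : ℕ)
                     (1+1≈0 : HasCharacteristicTwo (Field.commutativeRing K))
                     (^q-homo-+ : FiniteField.IsAdditivePower K q)
                     (x^q⁴≈x : FiniteField.IsIdentityPower K (q ^ 4))
                     (t : Field.Carrier K) (t∉𝔽q² : ¬ Geom.InFq2 K q t) where
  open Field K hiding (setoid; zero)
  open Geom K q
  open FiniteField K using (_^ᴿ_; pow≡^ᴿ; 1^≈1; *-cancelˡ; x≉0∧x*y≈0⇒y≈0; *-≉0)
  open CharacteristicTwo commutativeRing 1+1≈0
  open import Algebra.Properties.Semiring.Exp semiring using (^-congˡ; ^-homo-*; ^-assocʳ)
  open import Algebra.Properties.CommutativeSemiring.Exp commutativeSemiring using (^-distrib-*)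
  open import Relation.Binary.Reasoning.Setoid (Field.setoid K)

  pow-cong : ∀ n {x y} → x ≈ y → pow x n ≈ pow y n
  pow-cong n {x} {y} x≈y rewrite pow≡^ᴿ q x n | pow≡^ᴿ q y n = ^-congˡ n x≈y

  pow-homo-* : ∀ x m n → pow x (m ℕ.+ n) ≈ pow x m * pow x n
  pow-homo-* x m n rewrite pow≡^ᴿ q x (m ℕ.+ n) | pow≡^ᴿ q x m | pow≡^ᴿ q x n = ^-homo-* x m n

  pow-assoc : ∀ x m n → pow x (m ℕ.* n) ≈ pow (pow x m) n
  pow-assoc x m n rewrite pow≡^ᴿ q x (m ℕ.* n) | pow≡^ᴿ q (pow x m) n | pow≡^ᴿ q x m = sym (^-assocʳ x m n)

  σ : Carrier → Carrier
  σ x = pow x q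

  σ-homo-+ : ∀ x y → σ (x + y) ≈ σ x + σ y
  σ-homo-+ x y rewrite pow≡^ᴿ q (x + y) q | pow≡^ᴿ q x q | pow≡^ᴿ q y q = ^q-homo-+ x y

  σ² : Carrier → Carrier
  σ² x = σ (σ x)

  σ-cong : ∀ {x y} → x ≈ y → σ x ≈ σ y
  σ-cong = pow-cong q

  σ-homo-* : ∀ x y → σ (x * y) ≈ σ x * σ y
  σ-homo-* x y rewrite pow≡^ᴿ q (x * y) q | pow≡^ᴿ q x q | pow≡^ᴿ q y q = ^-distrib-* x y q

  σ-1 : σ 1# ≈ 1#
  σ-1 rewrite pow≡^ᴿ q 1# q = 1^≈1 q

  σ-0 : σ 0# ≈ 0#
  σ-0 = begin
    σ 0#           ≈⟨ σ-cong (+-identityʳ 0#) ⟨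
    σ (0# + 0#)    ≈⟨ σ-homo-+ 0# 0# ⟩
    σ 0# + σ 0#    ≈⟨ x+x≈0 (σ 0#) ⟩
    0#             ∎

  σ-lin : ∀ a x b y → σ (a * x + b * y) ≈ σ a * σ x + σ b * σ y
  σ-lin a x b y = trans (σ-homo-+ (a * x) (b * y)) (+-cong (σ-homo-* a x) (σ-homo-* b y))

  σ²-homo-+ : ∀ x y → σ² (x + y) ≈ σ² x + σ² y
  σ²-homo-+ x y = trans (σ-cong (σ-homo-+ x y)) (σ-homo-+ (σ x) (σ y))

  σ²-homo-* : ∀ x y → σ² (x * y) ≈ σ² x * σ² y
  σ²-homo-* x y = trans (σ-cong (σ-homo-* x y)) (σ-homo-* (σ x) (σ y))

  σ²-lin : ∀ a x b y → σ² (a * x + b * y) ≈ σ² a * σ² x + σ² b * σ² y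
  σ²-lin a x b y = trans (σ-cong (σ-lin a x b y)) (σ-lin (σ a) (σ x) (σ b) (σ y))

  pow-q² : ∀ x → pow x (q ^ 2) ≈ σ² x
  pow-q² x = trans (pow-assoc x q (q ^ 1)) (reflexive (≡.cong (pow (σ x)) (ℕ.*-identityʳ q)))

  pow-q³ : ∀ x → pow x (q ^ 3) ≈ σ (σ² x)
  pow-q³ x = trans (pow-assoc x q (q ^ 2)) (pow-q² (σ x))

  σ⁴ : ∀ x → σ² (σ² x) ≈ x
  σ⁴ x = begin
    σ² (σ² x)          ≈⟨ pow-q³ (σ x) ⟨
    pow (σ x) (q ^ 3)  ≈⟨ pow-assoc x q (q ^ 3) ⟨
    pow x (q ^ 4)      ≡⟨ pow≡^ᴿ q x (q ^ 4) ⟩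
    x ^ᴿ (q ^ 4)       ≈⟨ x^q⁴≈x x ⟩
    x                  ∎

  σ²-fixed⇒InFq2 : ∀ {x} → σ² x ≈ x → InFq2 x
  σ²-fixed⇒InFq2 {x} = trans (pow-q² x)

  InFq2⇒σ²-fixed : ∀ {x} → InFq2 x → σ² x ≈ x
  InFq2⇒σ²-fixed {x} = trans (sym (pow-q² x))

  t₁ t₂ t₃ : Carrier
  t₁ = σ t
  t₂ = σ t₁
  t₃ = σ t₂

  -- U and W are u_t and w_t with the exponents expanded; σ cycles U ↦ U′ ↦ W ↦ W′ ↦ U.
  U U′ W W′ : Vec4
  U  = vec4 1# t₁ t  (t₁ * t)
  U′ = vec4 1# t₂ t₁ (t₂ * t₁)
  W  = vec4 1# t₃ t₂ (t₃ * t₂)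
  W′ = vec4 1# t  t₃ (t * t₃)

  uₜ≋U : uₜ t ≋ U
  uₜ≋U 0F = refl
  uₜ≋U 1F = refl
  uₜ≋U 2F = refl
  uₜ≋U 3F = trans (pow-homo-* t q 1) (*-congˡ (*-identityʳ t))

  wₜ≋W : wₜ t ≋ W
  wₜ≋W 0F = refl
  wₜ≋W 1F = pow-q³ t
  wₜ≋W 2F = pow-q² t
  wₜ≋W 3F = trans (pow-homo-* t (q ^ 3) (q ^ 2)) (*-cong (pow-q³ t) (pow-q² t))

  σ-U : ∀ i → σ (U i) ≈ U′ i
  σ-U 0F = σ-1
  σ-U 1F = refl
  σ-U 2F = refl
  σ-U 3F = σ-homo-* t₁ t

  σ-U′ : ∀ i → σ (U′ i) ≈ W i
  σ-U′ 0F = σ-1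
  σ-U′ 1F = refl
  σ-U′ 2F = refl
  σ-U′ 3F = σ-homo-* t₂ t₁

  σ-W : ∀ i → σ (W i) ≈ W′ i
  σ-W 0F = σ-1
  σ-W 1F = σ⁴ t
  σ-W 2F = refl
  σ-W 3F = trans (σ-homo-* t₃ t₂) (*-congʳ (σ⁴ t))

  σ-W′ : ∀ i → σ (W′ i) ≈ U i
  σ-W′ 0F = σ-1
  σ-W′ 1F = refl
  σ-W′ 2F = σ⁴ t
  σ-W′ 3F = trans (σ-homo-* t t₃) (*-congˡ (σ⁴ t))

  D E : Carrier
  D = t + t₂
  E = t₁ + t₃

  D≉0 : ¬ D ≈ 0#
  D≉0 D≈0 = t∉𝔽q² (σ²-fixed⇒InFq2 (sym (+≈0⇒≈ D≈0)))

  E≉0 : ¬ E ≈ 0#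
  E≉0 E≈0 = t∉𝔽q² (σ²-fixed⇒InFq2 (trans (σ-cong (+≈0⇒≈ E≈0)) (σ⁴ t)))

  σ²-U : ∀ i → σ² (U i) ≈ W i
  σ²-U i = trans (σ-cong (σ-U i)) (σ-U′ i)

  σ²-W : ∀ i → σ² (W i) ≈ U i
  σ²-W i = trans (σ-cong (σ-W i)) (σ-W′ i)

  σ²-UW : ∀ a b i → σ² (a * U i + b * W i) ≈ σ² a * W i + σ² b * U i
  σ²-UW a b i = trans (σ²-lin a (U i) b (W i)) (+-cong (*-congˡ (σ²-U i)) (*-congˡ (σ²-W i)))

  -- The points of M_t with all coordinates in 𝔽_{q²}: ξ u_t + ξ^{q²} w_t.
  point : Carrier → Vec4
  point ξ = lin ξ U (σ² ξ) W

  point-cong : ∀ {ξ ζ} → ξ ≈ ζ → point ξ ≋ point ζ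
  point-cong ξ≈ζ i = +-cong (*-congʳ ξ≈ζ) (*-congʳ (σ-cong (σ-cong ξ≈ζ)))

  InV4q2-resp-≋ : ∀ {v w} → v ≋ w → InV4q2 v → InV4q2 w
  InV4q2-resp-≋ v≋w v∈ i = trans (pow-cong (q ^ 2) (sym (v≋w i))) (trans (v∈ i) (v≋w i))

  point∈V4q2 : ∀ ξ → InV4q2 (point ξ)
  point∈V4q2 ξ i = σ²-fixed⇒InFq2 (begin
    σ² (ξ * U i + σ² ξ * W i)     ≈⟨ σ²-UW ξ (σ² ξ) i ⟩
    σ² ξ * W i + σ² (σ² ξ) * U i  ≈⟨ +-congˡ (*-congʳ (σ⁴ ξ)) ⟩
    σ² ξ * W i + ξ * U i          ≈⟨ +-comm _ _ ⟩
    ξ * U i + σ² ξ * W i          ∎)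

  V4q2-combination⇒conjugate : ∀ {ξ μ} → InV4q2 (lin ξ U μ W) → μ ≈ σ² ξ
  V4q2-combination⇒conjugate {ξ} {μ} v∈ = sym (+≈0⇒≈ (x≉0∧x*y≈0⇒y≈0 D≉0 (begin
    D * (σ² ξ + μ)
      ≈⟨ solve 6 (λ t t₂ ξ μ ξ₂ μ₂ →
           (t :+ t₂) :* (ξ₂ :+ μ)
           := t :* ((ξ₂ :* con true :+ μ₂ :* con true) :+ (ξ :* con true :+ μ :* con true))
              :+ ((ξ₂ :* t₂ :+ μ₂ :* t) :+ (ξ :* t :+ μ :* t₂))) refl t t₂ ξ μ (σ² ξ) (σ² μ) ⟩
    t * ((σ² ξ * 1# + σ² μ * 1#) + (ξ * 1# + μ * 1#))
      + ((σ² ξ * t₂ + σ² μ * t) + (ξ * t + μ * t₂))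
      ≈⟨ +-cong (*-congˡ (≈⇒+≈0 (fixed 0F))) (≈⇒+≈0 (fixed 2F)) ⟩
    t * 0# + 0#
      ≈⟨ trans (+-identityʳ _) (zeroʳ t) ⟩
    0# ∎)))
    where
    fixed : ∀ i → σ² ξ * W i + σ² μ * U i ≈ ξ * U i + μ * W i
    fixed i = trans (sym (σ²-UW ξ μ i)) (InFq2⇒σ²-fixed (v∈ i))

  Inm⇒point : ∀ {v} → Inm t v → ∃ λ ξ → v ≋ point ξ
  Inm⇒point {v} ((ξ , μ , v≋) , v∈) = ξ , λ i → trans (v≋UW i) (+-congˡ (*-congʳ μ≈σ²ξ))
    where
    v≋UW : v ≋ lin ξ U μ W
    v≋UW i = trans (v≋ i) (+-cong (*-congˡ (uₜ≋U i)) (*-congˡ (wₜ≋W i)))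
    μ≈σ²ξ : μ ≈ σ² ξ
    μ≈σ²ξ = V4q2-combination⇒conjugate (InV4q2-resp-≋ v≋UW v∈)

  point⇒Inm : ∀ {v ξ} → v ≋ point ξ → Inm t v
  point⇒Inm {v} {ξ} v≋ = (ξ , σ² ξ , v≋M) , InV4q2-resp-≋ (λ i → sym (v≋ i)) (point∈V4q2 ξ)
    where
    v≋M : v ≋ lin ξ (uₜ t) (σ² ξ) (wₜ t)
    v≋M i = trans (v≋ i) (sym (+-cong (*-congˡ (uₜ≋U i)) (*-congˡ (wₜ≋W i))))

  σ²-𝔽q²-combination : ∀ {l m} → InFq2 l → InFq2 m → σ² (l + m * t) ≈ l + m * t₂
  σ²-𝔽q²-combination {l} {m} l∈ m∈ = trans (σ²-homo-+ l (m * t))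
    (+-cong (InFq2⇒σ²-fixed l∈) (trans (σ²-homo-* m t) (*-congʳ (InFq2⇒σ²-fixed m∈))))

  𝔽q²-decomposition : ∀ ξ → ∃ λ l → ∃ λ m → InFq2 l × InFq2 m × ξ ≈ l + m * t
  𝔽q²-decomposition ξ with inverse D D≉0
  ... | D⁻¹ , DD⁻¹≈1 = l , m , σ²-fixed⇒InFq2 σ²l≈l , σ²-fixed⇒InFq2 σ²m≈m ,
                       solve 3 (λ ξ m t → ξ := (ξ :+ m :* t) :+ m :* t) refl ξ m t
    where
    m l : Carrier
    m = D⁻¹ * (ξ + σ² ξ)
    l = ξ + m * t
    Dm≈ξ+σ²ξ : D * m ≈ ξ + σ² ξ
    Dm≈ξ+σ²ξ = trans (sym (*-assoc D D⁻¹ _)) (trans (*-congʳ DD⁻¹≈1) (*-identityˡ _))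
    σ²D≈D : σ² D ≈ D
    σ²D≈D = trans (σ²-homo-+ t t₂) (trans (+-congˡ (σ⁴ t)) (+-comm t₂ t))
    σ²m≈m : σ² m ≈ m
    σ²m≈m = *-cancelˡ D≉0 (begin
      D * σ² m       ≈⟨ *-congʳ σ²D≈D ⟨
      σ² D * σ² m    ≈⟨ σ²-homo-* D m ⟨
      σ² (D * m)     ≈⟨ σ-cong (σ-cong Dm≈ξ+σ²ξ) ⟩
      σ² (ξ + σ² ξ)  ≈⟨ trans (σ²-homo-+ ξ (σ² ξ)) (trans (+-congˡ (σ⁴ ξ)) (+-comm _ _)) ⟩
      ξ + σ² ξ       ≈⟨ Dm≈ξ+σ²ξ ⟨
      D * m          ∎)
    σ²l≈l : σ² l ≈ l
    σ²l≈l = sym (+≈0⇒≈ (begin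
      l + σ² l
        ≈⟨ +-congˡ (trans (σ²-homo-+ ξ (m * t)) (+-congˡ (trans (σ²-homo-* m t) (*-congʳ σ²m≈m)))) ⟩
      (ξ + m * t) + (σ² ξ + m * t₂)
        ≈⟨ solve 5 (λ ξ ξ₂ m t t₂ → (ξ :+ m :* t) :+ (ξ₂ :+ m :* t₂) := (ξ :+ ξ₂) :+ (t :+ t₂) :* m)
                   refl ξ (σ² ξ) m t t₂ ⟩
      (ξ + σ² ξ) + D * m
        ≈⟨ +-congˡ Dm≈ξ+σ²ξ ⟩
      (ξ + σ² ξ) + (ξ + σ² ξ)
        ≈⟨ x+x≈0 _ ⟩
      0# ∎))

  𝔽q²-independent : ∀ {l m} → InFq2 l → InFq2 m → l + m * t ≈ 0# → l ≈ 0# × m ≈ 0#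
  𝔽q²-independent {l} {m} l∈ m∈ l+mt≈0 = l≈0 , m≈0
    where
    l+mt₂≈0 : l + m * t₂ ≈ 0#
    l+mt₂≈0 = begin
      l + m * t₂       ≈⟨ σ²-𝔽q²-combination l∈ m∈ ⟨
      σ² (l + m * t)   ≈⟨ σ-cong (σ-cong l+mt≈0) ⟩
      σ² 0#            ≈⟨ trans (σ-cong σ-0) σ-0 ⟩
      0#               ∎
    m≈0 : m ≈ 0#
    m≈0 = x≉0∧x*y≈0⇒y≈0 D≉0 (begin
      D * m                       ≈⟨ solve 4 (λ l m t t₂ → (t :+ t₂) :* m := (l :+ m :* t) :+ (l :+ m :* t₂))
                                             refl l m t t₂ ⟩
      (l + m * t) + (l + m * t₂)  ≈⟨ +-cong l+mt≈0 l+mt₂≈0 ⟩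
      0# + 0#                     ≈⟨ +-identityʳ 0# ⟩
      0#                          ∎)
    l≈0 : l ≈ 0#
    l≈0 = begin
      l                    ≈⟨ solve 3 (λ l m t → l := (l :+ m :* t) :+ m :* t) refl l m t ⟩
      (l + m * t) + m * t  ≈⟨ +-cong l+mt≈0 (trans (*-congʳ m≈0) (zeroˡ t)) ⟩
      0# + 0#              ≈⟨ +-identityʳ 0# ⟩
      0#                   ∎

  lin-point : ∀ {l m} → InFq2 l → InFq2 m → lin l (point 1#) m (point t) ≋ point (l + m * t)
  lin-point {l} {m} l∈ m∈ i = begin
    l * (1# * U i + σ² 1# * W i) + m * (t * U i + t₂ * W i)
      ≈⟨ +-congʳ (*-congˡ (+-congˡ (*-congʳ (trans (σ-cong σ-1) σ-1)))) ⟩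
    l * (1# * U i + 1# * W i) + m * (t * U i + t₂ * W i)
      ≈⟨ solve 6 (λ l m t t₂ u w → l :* (con true :* u :+ con true :* w) :+ m :* (t :* u :+ t₂ :* w)
                                    := (l :+ m :* t) :* u :+ (l :+ m :* t₂) :* w) refl l m t t₂ (U i) (W i) ⟩
    (l + m * t) * U i + (l + m * t₂) * W i
      ≈⟨ +-congˡ (*-congʳ (σ²-𝔽q²-combination l∈ m∈)) ⟨
    (l + m * t) * U i + σ² (l + m * t) * W i ∎

  point-zero⇒≈0 : ∀ {ξ} → IsZero (point ξ) → ξ ≈ 0#
  point-zero⇒≈0 {ξ} z = x≉0∧x*y≈0⇒y≈0 D≉0 (begin
    D * ξ
      ≈⟨ solve 4 (λ ξ ξ₂ t t₂ → (t :+ t₂) :* ξ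
                               := t₂ :* (ξ :* con true :+ ξ₂ :* con true) :+ (ξ :* t :+ ξ₂ :* t₂))
                 refl ξ (σ² ξ) t t₂ ⟩
    t₂ * (ξ * 1# + σ² ξ * 1#) + (ξ * t + σ² ξ * t₂)
      ≈⟨ +-cong (*-congˡ (z 0F)) (z 2F) ⟩
    t₂ * 0# + 0#
      ≈⟨ trans (+-identityʳ _) (zeroʳ t₂) ⟩
    0# ∎)

  ≈0⇒point-zero : ∀ {ξ} → ξ ≈ 0# → IsZero (point ξ)
  ≈0⇒point-zero {ξ} ξ≈0 i = begin
    ξ * U i + σ² ξ * W i   ≈⟨ +-cong (*-congʳ ξ≈0) (*-congʳ (trans (σ-cong (trans (σ-cong ξ≈0) σ-0)) σ-0)) ⟩
    0# * U i + 0# * W i    ≈⟨ +-cong (zeroˡ (U i)) (zeroˡ (W i)) ⟩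
    0# + 0#                ≈⟨ +-identityʳ 0# ⟩
    0#                     ∎

  σ-point : ∀ ξ i → σ (point ξ i) ≈ σ ξ * U′ i + σ (σ² ξ) * W′ i
  σ-point ξ i = trans (σ-lin ξ (U i) (σ² ξ) (W i)) (+-cong (*-congˡ (σ-U i)) (*-congˡ (σ-W i)))

  h-cong : ∀ {X X′ Y Y′} → X ≋ X′ → Y ≋ Y′ → h X Y ≈ h X′ Y′
  h-cong X≋ Y≋ = +-cong (+-cong (+-cong (*-cong (X≋ 0F) (σ-cong (Y≋ 3F))) (*-cong (X≋ 1F) (σ-cong (Y≋ 1F))))
                                (*-cong (X≋ 2F) (σ-cong (Y≋ 2F))))
                        (*-cong (X≋ 3F) (σ-cong (Y≋ 0F)))

  point-isotropic : ∀ ξ μ → h (point ξ) (point μ) ≈ 0#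
  point-isotropic ξ μ = begin
    h (point ξ) (point μ)
      ≈⟨ +-cong (+-cong (+-cong (*-congˡ (σ-point μ 3F)) (*-congˡ (σ-point μ 1F))) (*-congˡ (σ-point μ 2F)))
                (*-congˡ (σ-point μ 0F)) ⟩
    (ξ * 1# + ξ₂ * 1#) * (μ₁ * (t₂ * t₁) + μ₃ * (t * t₃))
      + (ξ * t₁ + ξ₂ * t₃) * (μ₁ * t₂ + μ₃ * t)
      + (ξ * t + ξ₂ * t₂) * (μ₁ * t₁ + μ₃ * t₃)
      + (ξ * (t₁ * t) + ξ₂ * (t₃ * t₂)) * (μ₁ * 1# + μ₃ * 1#)
      ≈⟨ solve 8 (λ ξ ξ₂ μ₁ μ₃ t t₁ t₂ t₃ →
           (ξ :* con true :+ ξ₂ :* con true) :* (μ₁ :* (t₂ :* t₁) :+ μ₃ :* (t :* t₃))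
           :+ (ξ :* t₁ :+ ξ₂ :* t₃) :* (μ₁ :* t₂ :+ μ₃ :* t)
           :+ (ξ :* t :+ ξ₂ :* t₂) :* (μ₁ :* t₁ :+ μ₃ :* t₃)
           :+ (ξ :* (t₁ :* t) :+ ξ₂ :* (t₃ :* t₂)) :* (μ₁ :* con true :+ μ₃ :* con true)
           := con false) refl ξ ξ₂ μ₁ μ₃ t t₁ t₂ t₃ ⟩
    0# ∎
    where
    ξ₂ μ₁ μ₃ : Carrier
    ξ₂ = σ² ξ
    μ₁ = σ μ
    μ₃ = σ (σ² μ)

  module V̂∩point {v ξ α β x} (α∈𝔽q : InFq α) (β∈𝔽q : InFq β)
                 (v≋ : v ≋ vec4 α (σ x) x β) (v≋point : v ≋ point ξ) where
    ξ₁ ξ₂ ξ₃ : Carrier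
    ξ₁ = σ ξ
    ξ₂ = σ ξ₁
    ξ₃ = σ ξ₂

    coord : ∀ i → vec4 α (σ x) x β i ≈ point ξ i
    coord i = trans (sym (v≋ i)) (v≋point i)

    σ-coord : ∀ i → σ (vec4 α (σ x) x β i) ≈ ξ₁ * U′ i + ξ₃ * W′ i
    σ-coord i = trans (σ-cong (coord i)) (σ-point ξ i)

    σξ≈ξ : ξ₁ ≈ ξ
    σξ≈ξ = sym (+≈0⇒≈ (x≉0∧x*y≈0⇒y≈0 E≉0 (begin
      E * (ξ + ξ₁)
        ≈⟨ solve 6 (λ ξ ξ₁ ξ₂ ξ₃ t₁ t₃ →
             (t₁ :+ t₃) :* (ξ :+ ξ₁)
             := ((ξ :* t₁ :+ ξ₂ :* t₃) :+ (ξ₁ :* t₁ :+ ξ₃ :* t₃))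
                :+ t₃ :* ((ξ₁ :* con true :+ ξ₃ :* con true) :+ (ξ :* con true :+ ξ₂ :* con true)))
             refl ξ ξ₁ ξ₂ ξ₃ t₁ t₃ ⟩
      ((ξ * t₁ + ξ₂ * t₃) + (ξ₁ * t₁ + ξ₃ * t₃)) + t₃ * ((ξ₁ * 1# + ξ₃ * 1#) + (ξ * 1# + ξ₂ * 1#))
        ≈⟨ +-cong (≈⇒+≈0 (trans (sym (coord 1F)) (σ-coord 2F)))
                  (*-congˡ (≈⇒+≈0 (trans (sym (σ-coord 0F)) (trans α∈𝔽q (coord 0F))))) ⟩
      0# + t₃ * 0#
        ≈⟨ trans (+-identityˡ _) (zeroʳ t₃) ⟩
      0# ∎)))

    ξ≈0 : ξ ≈ 0#
    ξ≈0 = x≉0∧x*y≈0⇒y≈0 (*-≉0 D≉0 E≉0) (begin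
      (D * E) * ξ
        ≈⟨ solve 5 (λ ξ t t₁ t₂ t₃ → ((t :+ t₂) :* (t₁ :+ t₃)) :* ξ
                     := (ξ :* (t₂ :* t₁) :+ ξ :* (t :* t₃)) :+ (ξ :* (t₁ :* t) :+ ξ :* (t₃ :* t₂)))
                   refl ξ t t₁ t₂ t₃ ⟩
      (ξ * (t₂ * t₁) + ξ * (t * t₃)) + (ξ * (t₁ * t) + ξ * (t₃ * t₂))
        ≈⟨ +-congʳ (+-cong (*-congʳ σξ≈ξ) (*-congʳ σ³ξ≈ξ)) ⟨
      (ξ₁ * (t₂ * t₁) + ξ₃ * (t * t₃)) + (ξ * (t₁ * t) + ξ * (t₃ * t₂))
        ≈⟨ +-congˡ (+-congˡ (*-congʳ σ²ξ≈ξ)) ⟨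
      (ξ₁ * (t₂ * t₁) + ξ₃ * (t * t₃)) + (ξ * (t₁ * t) + ξ₂ * (t₃ * t₂))
        ≈⟨ ≈⇒+≈0 (trans (sym (σ-coord 3F)) (trans β∈𝔽q (coord 3F))) ⟩
      0# ∎)
      where
      σ²ξ≈ξ : ξ₂ ≈ ξ
      σ²ξ≈ξ = trans (σ-cong σξ≈ξ) σξ≈ξ
      σ³ξ≈ξ : ξ₃ ≈ ξ
      σ³ξ≈ξ = trans (σ-cong σ²ξ≈ξ) σξ≈ξ

  a b : Vec4
  a = point 1#
  b = point t

  Span : Vec4 → Set (c ⊔ ℓ)
  Span v = ∃ λ l → ∃ λ m → InFq2 l × InFq2 m × v ≋ lin l a m b

  ab-independent : ∀ l m → InFq2 l → InFq2 m → IsZero (lin l a m b) → l ≈ 0# × m ≈ 0#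
  ab-independent l m l∈ m∈ z = 𝔽q²-independent l∈ m∈ (point-zero⇒≈0 λ i → trans (sym (lin-point l∈ m∈ i)) (z i))

  point⇒Span : ∀ {v} ξ → v ≋ point ξ → Span v
  point⇒Span {v} ξ v≋ = span (𝔽q²-decomposition ξ)
    where
    span : (∃ λ l → ∃ λ m → InFq2 l × InFq2 m × ξ ≈ l + m * t) → Span v
    span (l , m , l∈ , m∈ , ξ≈) = l , m , l∈ , m∈ , λ i →
      trans (v≋ i) (trans (point-cong ξ≈ i) (sym (lin-point l∈ m∈ i)))

  Inm⇒Span : ∀ {v} → Inm t v → Span v
  Inm⇒Span v∈m = uncurry point⇒Span (Inm⇒point v∈m)

  Span⇒Inm : ∀ {v} → Span v → Inm t v
  Span⇒Inm (l , m , l∈ , m∈ , v≋) = point⇒Inm λ i → trans (v≋ i) (lin-point l∈ m∈ i)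

  m-isotropic : ∀ X Y → Inm t X → Inm t Y → h X Y ≈ 0#
  m-isotropic X Y X∈m Y∈m =
    let (ξ , X≋) = Inm⇒point X∈m; (μ , Y≋) = Inm⇒point Y∈m
    in trans (h-cong X≋ Y≋) (point-isotropic ξ μ)

  m-isHermitianLine : IsHermitianLine (Inm t)
  m-isHermitianLine =
    (a , b , point∈V4q2 1# , point∈V4q2 t , ab-independent , λ v → Inm⇒Span , Span⇒Inm) , m-isotropic

  m-disjoint : DisjointFromWhat (Inm t)
  m-disjoint v (α , β , x , α∈𝔽q , β∈𝔽q , _ , v≋) v≉0 v∈m =
    let (ξ , v≋point) = Inm⇒point v∈m
    in v≉0 λ i → trans (v≋point i) (≈0⇒point-zero (V̂∩point.ξ≈0 α∈𝔽q β∈𝔽q v≋ v≋point) i)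

lemma2 : ∀ {c ℓ} (K : Field c ℓ) (q : ℕ) → 2 ∣ q →
         Bijection (setoid (Fin (q ^ 4))) (Field.setoid K) →
         (t : Field.Carrier K) → ¬ (Field._≈_ K (Geom.pow K q t (q ^ 2)) t) →
         Geom.IsHermitianLine K q (Geom.Inm K q t)
           × Geom.DisjointFromWhat K q (Geom.Inm K q t)
lemma2 K q 2∣q enum t t∉𝔽q² = m-isHermitianLine , m-disjoint
  where
  open Field K using (+-abelianGroup; commutativeRing)
  open FiniteField K using (IsAdditivePower; x^card≈x; even-card⇒1+1≈0)

  q∣q⁴ : q ∣ q ^ 4
  q∣q⁴ = m∣m*n (q ^ 3)

  1+1≈0 : HasCharacteristicTwo commutativeRing
  1+1≈0 = even-card⇒1+1≈0 (∣-trans 2∣q q∣q⁴) enum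
  open CharacteristicTwo commutativeRing 1+1≈0 using (x+x≈0; frobenius)

  q≡2^e : ∃ λ e → q ≡ 2 ^ e
  q≡2^e = let (d , q⁴≡2^d) = ExponentTwo.card≡2^ +-abelianGroup x+x≈0 enum
          in ∣2^⇒≡2^ d (≡.subst (q ∣_) q⁴≡2^d q∣q⁴)

  ^q-homo-+ : IsAdditivePower q
  ^q-homo-+ = let (e , q≡2^e) = q≡2^e in ≡.subst IsAdditivePower (≡.sym q≡2^e) (frobenius e)

  open HermitianLine K q 1+1≈0 ^q-homo-+ (x^card≈x enum) t t∉𝔽q²
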